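{- Let $n\ge1$ and let $M_n$ be the array indexed by $[0,n]^3$ with entries \[(M_n)_{i,j,k}=\min\big(k\min(i,j),\ ij-(n-k)\max(0,i+j-n)\big).\] Then $M_n$ is a corner-sum hypermatrix of order $n$, and it is the unique minimum element of $\mathcal{C}_n$ under the order $C\preceq D\iff C\ge D$ entrywise; that is, $M_n\ge C$ entrywise for every $C\in\mathcal{C}_n$.
   Context: $\mathcal{C}_n$ is the set of corner-sum hypermatrices of order $n$: integer arrays $C$ indexed by $[0,n]^3$ with $C_{i,j,0}=C_{i,0,j}=C_{0,i,j}=0$, $C_{i,j,n}=C_{i,n,j}=C_{n,i,j}=ij$ for all $i,j\in[0,n]$, and for all $i,j\in[0,n]$, $1\le k\le n$, each of $C_{i,j,k}-C_{i,j,k-1}$, $C_{i,k,j}-C_{i,k-1,j}$, $C_{k,i,j}-C_{k-1,i,j}$ in $\{\max(0,i+j-n),\dots,\min(i,j)\}$. -}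

module Defs where

open import Data.Nat as ℕ using (ℕ; suc; _⊔_; _⊓_; _∸_)
open import Data.Integer as ℤ using (ℤ; +_; _-_)
open import Data.Product using (_×_)
open import Relation.Binary.PropositionalEquality using (_≡_)

-- A (candidate) hypermatrix of order n: an integer array indexed by triples
-- of naturals; only the entries with indices in [0,n]^3 are relevant.
Array : Set
Array = ℕ → ℕ → ℕ → ℤ

_∈[_,_] : ℤ → ℕ → ℕ → Set
a ∈[ lo , hi ] = (+ lo ℤ.≤ a) × (a ℤ.≤ + hi)

-- max(0, i+j-n) = (i+j) ∸ n  and  min(i,j) = i ⊓ j
lowB : ℕ → ℕ → ℕ → ℕ
lowB n i j = (i ℕ.+ j) ∸ n

record IsCornerSum (n : ℕ) (C : Array) : Set where
  field
    zero₃ : ∀ i j → i ℕ.≤ n → j ℕ.≤ n → C i j 0 ≡ + 0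
    zero₂ : ∀ i j → i ℕ.≤ n → j ℕ.≤ n → C i 0 j ≡ + 0
    zero₁ : ∀ i j → i ℕ.≤ n → j ℕ.≤ n → C 0 i j ≡ + 0
    full₃ : ∀ i j → i ℕ.≤ n → j ℕ.≤ n → C i j n ≡ + (i ℕ.* j)
    full₂ : ∀ i j → i ℕ.≤ n → j ℕ.≤ n → C i n j ≡ + (i ℕ.* j)
    full₁ : ∀ i j → i ℕ.≤ n → j ℕ.≤ n → C n i j ≡ + (i ℕ.* j)
    step₃ : ∀ i j k → i ℕ.≤ n → j ℕ.≤ n → 1 ℕ.≤ k → k ℕ.≤ n →
            (C i j k - C i j (k ∸ 1)) ∈[ lowB n i j , i ⊓ j ]
    step₂ : ∀ i j k → i ℕ.≤ n → j ℕ.≤ n → 1 ℕ.≤ k → k ℕ.≤ n →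
            (C i k j - C i (k ∸ 1) j) ∈[ lowB n i j , i ⊓ j ]
    step₁ : ∀ i j k → i ℕ.≤ n → j ℕ.≤ n → 1 ℕ.≤ k → k ℕ.≤ n →
            (C k i j - C (k ∸ 1) i j) ∈[ lowB n i j , i ⊓ j ]

M : ℕ → Array
M n i j k = (+ (k ℕ.* (i ⊓ j))) ℤ.⊓ (+ (i ℕ.* j) - + ((n ∸ k) ℕ.* lowB n i j))

-- Climbing
-- from the bottom face gives C ≤ k·min(i,j); descending from the top face gives
-- C ≤ ij − (n−k)·max(0, i+j−n); hence C ≤ M.  Conversely M is the pointwise
-- minimum of the two extreme line profiles, so its increments in k are those of
-- a minimum of two sequences with increments min(i,j) and max(0, i+j−n).  Since
-- M equals min(ij, jk, ki, (n−i)(n−j) − k(n−i−j)), which is symmetric in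
-- i, j, k, the conditions in the other two directions follow.
module Submission where

open import Defs
open import Data.Nat using (ℕ; _≤_)
open import Data.Integer using ()
open import Data.Product using (_×_)

open import Data.Product using (_,_; proj₁; proj₂)
open import Data.Nat as ℕ using (zero; suc; _<_; _∸_; z≤n; s≤s)
import Data.Nat.Properties as ℕₚ
open import Data.Integer as ℤ using (ℤ; +_; _+_; _-_; -_; _*_; _⊓_)
import Data.Integer.Properties as ℤₚ
open import Data.Integer.Tactic.RingSolver using (solve-∀)
open import Algebra.Properties.CommutativeSemigroup ℤₚ.⊓-commutativeSemigroup
  using (xy∙z≈zy∙x; xy∙z≈yz∙x)
open import Relation.Binary.PropositionalEquality
open import Relation.Nullary using (yes; no)

pos-∸ : ∀ {m n} → n ≤ m → + (m ∸ n) ≡ + m - + n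
pos-∸ {m} {n} n≤m = sym (trans (ℤₚ.m-n≡m⊖n m n) (ℤₚ.⊖-≥ n≤m))

+-distribʳ-⊓ : ∀ c x y → (x ⊓ y) + c ≡ (x + c) ⊓ (y + c)
+-distribʳ-⊓ c = ℤₚ.mono-≤-distrib-⊓ (ℤₚ.+-monoˡ-≤ c)

[x+c]-x≡c : ∀ x c → (x + c) - x ≡ c
[x+c]-x≡c = solve-∀

x+c≤y⇒c≤y-x : ∀ {x y c} → x + c ℤ.≤ y → c ℤ.≤ y - x
x+c≤y⇒c≤y-x {x} {y} {c} h =
  subst (ℤ._≤ y - x) ([x+c]-x≡c x c) (ℤₚ.+-monoˡ-≤ (- x) h)

y≤x+c⇒y-x≤c : ∀ {x y c} → y ℤ.≤ x + c → y - x ℤ.≤ c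
y≤x+c⇒y-x≤c {x} {y} {c} h =
  subst (y - x ℤ.≤_) ([x+c]-x≡c x c) (ℤₚ.+-monoˡ-≤ (- x) h)

c≤x-y⇒y≤x-c : ∀ {x y c} → c ℤ.≤ x - y → y ℤ.≤ x - c
c≤x-y⇒y≤x-c {x} {y} h =
  subst (ℤ._≤ _) (x-[x-y]≡y x y) (ℤₚ.+-monoʳ-≤ x (ℤₚ.neg-mono-≤ h))
  where
    x-[x-y]≡y : ∀ x y → x - (x - y) ≡ y
    x-[x-y]≡y = solve-∀

module _ (f : ℕ → ℤ) {n : ℕ} where
  private
    telescope : ∀ x y z → x - z ≡ (x - y) + (y - z)
    telescope = solve-∀

  increments≤⇒growth≤ : ∀ {u} → (∀ k → k < n → f (suc k) - f k ℤ.≤ + u) →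
                        ∀ d k → d ℕ.+ k ≤ n → f (d ℕ.+ k) - f k ℤ.≤ + (d ℕ.* u)
  increments≤⇒growth≤ inc zero    k _ = ℤₚ.≤-reflexive (ℤₚ.+-inverseʳ (f k))
  increments≤⇒growth≤ {u} inc (suc d) k d+k<n = begin
    f (suc d ℕ.+ k) - f k                                   ≡⟨ telescope (f (suc d ℕ.+ k)) (f (d ℕ.+ k)) (f k) ⟩
    (f (suc (d ℕ.+ k)) - f (d ℕ.+ k)) + (f (d ℕ.+ k) - f k)  ≤⟨ ℤₚ.+-mono-≤ (inc (d ℕ.+ k) d+k<n)
                                                                 (increments≤⇒growth≤ inc d k (ℕₚ.<⇒≤ d+k<n)) ⟩
    + u + + (d ℕ.* u)                                        ≡⟨ ℤₚ.pos-+ u (d ℕ.* u) ⟨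
    + (suc d ℕ.* u)                                          ∎
    where open ℤₚ.≤-Reasoning

  increments≥⇒growth≥ : ∀ {l} → (∀ k → k < n → + l ℤ.≤ f (suc k) - f k) →
                        ∀ d k → d ℕ.+ k ≤ n → + (d ℕ.* l) ℤ.≤ f (d ℕ.+ k) - f k
  increments≥⇒growth≥ inc zero    k _ = ℤₚ.≤-reflexive (sym (ℤₚ.+-inverseʳ (f k)))
  increments≥⇒growth≥ {l} inc (suc d) k d+k<n = begin
    + (suc d ℕ.* l)                                          ≡⟨ ℤₚ.pos-+ l (d ℕ.* l) ⟩
    + l + + (d ℕ.* l)                                        ≤⟨ ℤₚ.+-mono-≤ (inc (d ℕ.+ k) d+k<n)
                                                                 (increments≥⇒growth≥ inc d k (ℕₚ.<⇒≤ d+k<n)) ⟩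
    (f (suc (d ℕ.+ k)) - f (d ℕ.+ k)) + (f (d ℕ.+ k) - f k)  ≡⟨ telescope (f (suc d ℕ.+ k)) (f (d ℕ.+ k)) (f k) ⟨
    f (suc d ℕ.+ k) - f k                                   ∎
    where open ℤₚ.≤-Reasoning

⊓-increment∈ : ∀ (x y : ℤ) {l u} → l ≤ u → (((x + + u) ⊓ (y + + l)) - (x ⊓ y)) ∈[ l , u ]
⊓-increment∈ x y {l} {u} l≤u = x+c≤y⇒c≤y-x lower , y≤x+c⇒y-x≤c upper
  where
    lower : (x ⊓ y) + + l ℤ.≤ (x + + u) ⊓ (y + + l)
    lower = subst (ℤ._≤ (x + + u) ⊓ (y + + l)) (sym (+-distribʳ-⊓ (+ l) x y))
              (ℤₚ.⊓-monoˡ-≤ (y + + l) (ℤₚ.+-monoʳ-≤ x (ℤ.+≤+ l≤u)))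
    upper : (x + + u) ⊓ (y + + l) ℤ.≤ (x ⊓ y) + + u
    upper = subst ((x + + u) ⊓ (y + + l) ℤ.≤_) (sym (+-distribʳ-⊓ (+ u) x y))
              (ℤₚ.⊓-monoʳ-≤ (x + + u) (ℤₚ.+-monoʳ-≤ y (ℤ.+≤+ l≤u)))

module _ {n : ℕ} {C : Array}
  (swap   : ∀ i j k → i ≤ n → j ≤ n → k ≤ n → C i k j ≡ C i j k)
  (rotate : ∀ i j k → i ≤ n → j ≤ n → k ≤ n → C k i j ≡ C i j k)
  (bottom : ∀ i j → i ≤ n → j ≤ n → C i j 0 ≡ + 0)
  (top    : ∀ i j → i ≤ n → j ≤ n → C i j n ≡ + (i ℕ.* j))
  (step   : ∀ i j k → i ≤ n → j ≤ n → k < n →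
            (C i j (suc k) - C i j k) ∈[ lowB n i j , i ℕ.⊓ j ])
  where

  private
    step-of : (P : Array) → (∀ i j k → i ≤ n → j ≤ n → k ≤ n → P i j k ≡ C i j k) →
              ∀ i j k → i ≤ n → j ≤ n → 1 ≤ k → k ≤ n →
              (P i j k - P i j (k ∸ 1)) ∈[ lowB n i j , i ℕ.⊓ j ]
    step-of P P≡C i j (suc k) i≤n j≤n _ k<n =
      subst₂ (λ a b → (a - b) ∈[ lowB n i j , i ℕ.⊓ j ])
        (sym (P≡C i j (suc k) i≤n j≤n k<n)) (sym (P≡C i j k i≤n j≤n (ℕₚ.<⇒≤ k<n)))
        (step i j k i≤n j≤n k<n)

  symmetric⇒isCornerSum : IsCornerSum n C
  symmetric⇒isCornerSum = record
    { zero₃ = bottom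
    ; zero₂ = λ i j i≤n j≤n → trans (swap i j 0 i≤n j≤n z≤n) (bottom i j i≤n j≤n)
    ; zero₁ = λ i j i≤n j≤n → trans (rotate i j 0 i≤n j≤n z≤n) (bottom i j i≤n j≤n)
    ; full₃ = top
    ; full₂ = λ i j i≤n j≤n → trans (swap i j n i≤n j≤n ℕₚ.≤-refl) (top i j i≤n j≤n)
    ; full₁ = λ i j i≤n j≤n → trans (rotate i j n i≤n j≤n ℕₚ.≤-refl) (top i j i≤n j≤n)
    ; step₃ = step-of C (λ _ _ _ _ _ _ → refl)
    ; step₂ = step-of (λ i j k → C i k j) swap
    ; step₁ = step-of (λ i j k → C k i j) rotate
    }

Q : ℕ → ℕ → ℕ → ℕ → ℤ
Q n i j k = (+ n - + i) * (+ n - + j) - + k * (+ n - + i - + j)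

ij-[n∸k]lowB≡ij⊓Q : ∀ n i j {k} → k ≤ n →
                    + (i ℕ.* j) - + ((n ∸ k) ℕ.* lowB n i j) ≡ + (i ℕ.* j) ⊓ Q n i j k
ij-[n∸k]lowB≡ij⊓Q n i j {k} k≤n with i ℕ.+ j ℕ.≤? n
... | yes i+j≤n = begin
    + (i ℕ.* j) - + ((n ∸ k) ℕ.* lowB n i j)  ≡⟨ cong (λ l → + (i ℕ.* j) - + ((n ∸ k) ℕ.* l)) (ℕₚ.m≤n⇒m∸n≡0 i+j≤n) ⟩
    + (i ℕ.* j) - + ((n ∸ k) ℕ.* 0)          ≡⟨ cong (λ p → + (i ℕ.* j) - + p) (ℕₚ.*-zeroʳ (n ∸ k)) ⟩
    + (i ℕ.* j) + + 0                        ≡⟨ ℤₚ.+-identityʳ (+ (i ℕ.* j)) ⟩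
    + (i ℕ.* j)                              ≡⟨ ℤₚ.i≤j⇒i⊓j≡i ij≤Q ⟨
    + (i ℕ.* j) ⊓ Q n i j k                  ∎
  where
    open ≡-Reasoning
    Q≡ij+slack : ∀ N I J K → (N - I) * (N - J) - K * (N - I - J) ≡ I * J + (N - K) * (N - (I + J))
    Q≡ij+slack = solve-∀
    slack : + ((n ∸ k) ℕ.* (n ∸ (i ℕ.+ j))) ≡ (+ n - + k) * (+ n - (+ i + + j))
    slack = trans (ℤₚ.pos-* (n ∸ k) (n ∸ (i ℕ.+ j)))
              (cong₂ _*_ (pos-∸ k≤n) (trans (pos-∸ i+j≤n) (cong (λ t → + n - t) (ℤₚ.pos-+ i j))))
    ij≤Q : + (i ℕ.* j) ℤ.≤ Q n i j k
    ij≤Q = subst (+ (i ℕ.* j) ℤ.≤_)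
             (sym (trans (Q≡ij+slack (+ n) (+ i) (+ j) (+ k))
                         (cong₂ _+_ (sym (ℤₚ.pos-* i j)) (sym slack))))
             (ℤₚ.i≤i+j (+ (i ℕ.* j)) (+ ((n ∸ k) ℕ.* (n ∸ (i ℕ.+ j)))))
... | no i+j≰n = begin
    + (i ℕ.* j) - + ((n ∸ k) ℕ.* lowB n i j)  ≡⟨ ij-[n∸k]lowB≡Q ⟩
    Q n i j k                                ≡⟨ ℤₚ.i≥j⇒i⊓j≡j Q≤ij ⟨
    + (i ℕ.* j) ⊓ Q n i j k                  ∎
  where
    open ≡-Reasoning
    Q≡ij-excess : ∀ N I J K → I * J - (N - K) * ((I + J) - N) ≡ (N - I) * (N - J) - K * (N - I - J)
    Q≡ij-excess = solve-∀
    excess : + ((n ∸ k) ℕ.* lowB n i j) ≡ (+ n - + k) * ((+ i + + j) - + n)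
    excess = trans (ℤₚ.pos-* (n ∸ k) (lowB n i j))
               (cong₂ _*_ (pos-∸ k≤n)
                 (trans (pos-∸ (ℕₚ.<⇒≤ (ℕₚ.≰⇒> i+j≰n))) (cong (_- + n) (ℤₚ.pos-+ i j))))
    ij-[n∸k]lowB≡Q : + (i ℕ.* j) - + ((n ∸ k) ℕ.* lowB n i j) ≡ Q n i j k
    ij-[n∸k]lowB≡Q = trans (cong₂ _-_ (ℤₚ.pos-* i j) excess) (Q≡ij-excess (+ n) (+ i) (+ j) (+ k))
    Q≤ij : Q n i j k ℤ.≤ + (i ℕ.* j)
    Q≤ij = subst (ℤ._≤ + (i ℕ.* j)) ij-[n∸k]lowB≡Q (ℤₚ.m-n≤m (+ (i ℕ.* j)) ((n ∸ k) ℕ.* lowB n i j))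

Msym : ℕ → Array
Msym n i j k = (+ (i ℕ.* j) ⊓ + (j ℕ.* k)) ⊓ + (k ℕ.* i) ⊓ Q n i j k

M≡Msym : ∀ n i j k → k ≤ n → M n i j k ≡ Msym n i j k
M≡Msym n i j k k≤n = begin
  M n i j k
    ≡⟨ cong₂ _⊓_ (cong +_ (ℕₚ.*-distribˡ-⊓ k i j)) (ij-[n∸k]lowB≡ij⊓Q n i j k≤n) ⟩
  (+ (k ℕ.* i) ⊓ + (k ℕ.* j)) ⊓ (+ (i ℕ.* j) ⊓ Q n i j k)
    ≡⟨ ℤₚ.⊓-assoc _ _ _ ⟨
  (+ (k ℕ.* i) ⊓ + (k ℕ.* j)) ⊓ + (i ℕ.* j) ⊓ Q n i j k
    ≡⟨ cong (_⊓ Q n i j k) (xy∙z≈zy∙x (+ (k ℕ.* i)) (+ (k ℕ.* j)) (+ (i ℕ.* j))) ⟩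
  (+ (i ℕ.* j) ⊓ + (k ℕ.* j)) ⊓ + (k ℕ.* i) ⊓ Q n i j k
    ≡⟨ cong (λ p → (+ (i ℕ.* j) ⊓ + p) ⊓ + (k ℕ.* i) ⊓ Q n i j k) (ℕₚ.*-comm k j) ⟩
  Msym n i j k ∎
  where open ≡-Reasoning

Msym-swap : ∀ n i j k → Msym n i k j ≡ Msym n i j k
Msym-swap n i j k = cong₂ _⊓_ products (Q-swap (+ n) (+ i) (+ j) (+ k))
  where
    Q-swap : ∀ N I J K → (N - I) * (N - K) - J * (N - I - K) ≡ (N - I) * (N - J) - K * (N - I - J)
    Q-swap = solve-∀
    products : (+ (i ℕ.* k) ⊓ + (k ℕ.* j)) ⊓ + (j ℕ.* i) ≡ (+ (i ℕ.* j) ⊓ + (j ℕ.* k)) ⊓ + (k ℕ.* i)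
    products = trans
      (cong₂ _⊓_ (cong₂ _⊓_ (cong +_ (ℕₚ.*-comm i k)) (cong +_ (ℕₚ.*-comm k j))) (cong +_ (ℕₚ.*-comm j i)))
      (xy∙z≈zy∙x (+ (k ℕ.* i)) (+ (j ℕ.* k)) (+ (i ℕ.* j)))

Msym-rotate : ∀ n i j k → Msym n k i j ≡ Msym n i j k
Msym-rotate n i j k =
  cong₂ _⊓_ (xy∙z≈yz∙x (+ (k ℕ.* i)) (+ (i ℕ.* j)) (+ (j ℕ.* k))) (Q-rotate (+ n) (+ i) (+ j) (+ k))
  where
    Q-rotate : ∀ N I J K → (N - K) * (N - I) - J * (N - K - I) ≡ (N - I) * (N - J) - K * (N - I - J)
    Q-rotate = solve-∀

M-swap : ∀ n i j k → i ≤ n → j ≤ n → k ≤ n → M n i k j ≡ M n i j k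
M-swap n i j k _ j≤n k≤n =
  trans (M≡Msym n i k j j≤n) (trans (Msym-swap n i j k) (sym (M≡Msym n i j k k≤n)))

M-rotate : ∀ n i j k → i ≤ n → j ≤ n → k ≤ n → M n k i j ≡ M n i j k
M-rotate n i j k _ j≤n k≤n =
  trans (M≡Msym n k i j j≤n) (trans (Msym-rotate n i j k) (sym (M≡Msym n i j k k≤n)))

M-bottom : ∀ n i j → i ≤ n → j ≤ n → M n i j 0 ≡ + 0
M-bottom n i j i≤n j≤n = ℤₚ.i≤j⇒i⊓j≡i 0≤ij-[n]lowB
  where
    Q₀ : ∀ N I J → (N - I) * (N - J) - + 0 * (N - I - J) ≡ (N - I) * (N - J)
    Q₀ = solve-∀
    Q≡[n∸i][n∸j] : Q n i j 0 ≡ + ((n ∸ i) ℕ.* (n ∸ j))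
    Q≡[n∸i][n∸j] = trans (Q₀ (+ n) (+ i) (+ j))
      (trans (cong₂ _*_ (sym (pos-∸ i≤n)) (sym (pos-∸ j≤n))) (sym (ℤₚ.pos-* (n ∸ i) (n ∸ j))))
    0≤ij-[n]lowB : + 0 ℤ.≤ + (i ℕ.* j) - + ((n ∸ 0) ℕ.* lowB n i j)
    0≤ij-[n]lowB = subst (+ 0 ℤ.≤_) (sym (ij-[n∸k]lowB≡ij⊓Q n i j z≤n))
      (ℤₚ.⊓-glb (ℤ.+≤+ z≤n) (subst (+ 0 ℤ.≤_) (sym Q≡[n∸i][n∸j]) (ℤ.+≤+ z≤n)))

M-top : ∀ n i j → i ≤ n → j ≤ n → M n i j n ≡ + (i ℕ.* j)
M-top n i j i≤n j≤n = begin
  + (n ℕ.* (i ℕ.⊓ j)) ⊓ (+ (i ℕ.* j) - + ((n ∸ n) ℕ.* lowB n i j))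
    ≡⟨ cong (λ d → + (n ℕ.* (i ℕ.⊓ j)) ⊓ (+ (i ℕ.* j) - + (d ℕ.* lowB n i j))) (ℕₚ.n∸n≡0 n) ⟩
  + (n ℕ.* (i ℕ.⊓ j)) ⊓ (+ (i ℕ.* j) + + 0)
    ≡⟨ cong (+ (n ℕ.* (i ℕ.⊓ j)) ⊓_) (ℤₚ.+-identityʳ (+ (i ℕ.* j))) ⟩
  + (n ℕ.* (i ℕ.⊓ j)) ⊓ + (i ℕ.* j)
    ≡⟨ ℤₚ.i≥j⇒i⊓j≡j (ℤ.+≤+ ij≤n[i⊓j]) ⟩
  + (i ℕ.* j) ∎
  where
    open ≡-Reasoning
    ij≤n[i⊓j] : i ℕ.* j ≤ n ℕ.* (i ℕ.⊓ j)
    ij≤n[i⊓j] = subst (i ℕ.* j ≤_) (sym (ℕₚ.*-distribˡ-⊓ n i j))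
      (ℕₚ.⊓-glb (subst (_≤ n ℕ.* i) (ℕₚ.*-comm j i) (ℕₚ.*-monoˡ-≤ i j≤n)) (ℕₚ.*-monoˡ-≤ j i≤n))

lowB≤⊓ : ∀ n i j → i ≤ n → j ≤ n → lowB n i j ≤ i ℕ.⊓ j
lowB≤⊓ n i j i≤n j≤n = ℕₚ.⊓-glb
  (ℕₚ.≤-trans (ℕₚ.∸-monoˡ-≤ n (ℕₚ.+-monoʳ-≤ i j≤n)) (ℕₚ.≤-reflexive (ℕₚ.m+n∸n≡m i n)))
  (ℕₚ.≤-trans (ℕₚ.∸-monoˡ-≤ n (ℕₚ.+-monoˡ-≤ j i≤n)) (ℕₚ.≤-reflexive (ℕₚ.m+n∸m≡n n j)))

M-step : ∀ n i j k → i ≤ n → j ≤ n → k < n →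
         (M n i j (suc k) - M n i j k) ∈[ lowB n i j , i ℕ.⊓ j ]
M-step n i j k i≤n j≤n k<n =
  subst (λ t → (t - M n i j k) ∈[ l , u ])
    (sym (cong₂ _⊓_ rising falling))
    (⊓-increment∈ (+ (k ℕ.* u)) (+ (i ℕ.* j) - + ((n ∸ k) ℕ.* l)) (lowB≤⊓ n i j i≤n j≤n))
  where
    u = i ℕ.⊓ j
    l = lowB n i j
    X-E≡[X-[L+E]]+L : ∀ X L E → X - E ≡ (X - (L + E)) + L
    X-E≡[X-[L+E]]+L = solve-∀
    rising : + (suc k ℕ.* u) ≡ + (k ℕ.* u) + + u
    rising = trans (ℤₚ.pos-+ u (k ℕ.* u)) (ℤₚ.+-comm (+ u) (+ (k ℕ.* u)))
    falling : + (i ℕ.* j) - + ((n ∸ suc k) ℕ.* l) ≡ (+ (i ℕ.* j) - + ((n ∸ k) ℕ.* l)) + + l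
    falling = begin
      + (i ℕ.* j) - + ((n ∸ suc k) ℕ.* l)
        ≡⟨ X-E≡[X-[L+E]]+L (+ (i ℕ.* j)) (+ l) (+ ((n ∸ suc k) ℕ.* l)) ⟩
      (+ (i ℕ.* j) - (+ l + + ((n ∸ suc k) ℕ.* l))) + + l
        ≡⟨ cong (λ e → (+ (i ℕ.* j) - e) + + l) (ℤₚ.pos-+ l ((n ∸ suc k) ℕ.* l)) ⟨
      (+ (i ℕ.* j) - + (suc (n ∸ suc k) ℕ.* l)) + + l
        ≡⟨ cong (λ d → (+ (i ℕ.* j) - + (d ℕ.* l)) + + l) (ℕₚ.+-∸-assoc 1 k<n) ⟨
      (+ (i ℕ.* j) - + ((n ∸ k) ℕ.* l)) + + l ∎
      where open ≡-Reasoning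

M-isCornerSum : ∀ n → IsCornerSum n (M n)
M-isCornerSum n =
  symmetric⇒isCornerSum (M-swap n) (M-rotate n) (M-bottom n) (M-top n) (M-step n)

module _ {n : ℕ} {C : Array} (isC : IsCornerSum n C) {i j : ℕ} (i≤n : i ≤ n) (j≤n : j ≤ n) where
  open IsCornerSum isC

  private
    increment∈ : ∀ k → k < n → (C i j (suc k) - C i j k) ∈[ lowB n i j , i ℕ.⊓ j ]
    increment∈ k = step₃ i j (suc k) i≤n j≤n (s≤s z≤n)

  cornerSum≤M : ∀ k → k ≤ n → C i j k ℤ.≤ M n i j k
  cornerSum≤M k k≤n = ℤₚ.⊓-glb below-rising below-falling
    where
      rise : C i j (k ℕ.+ 0) - C i j 0 ℤ.≤ + (k ℕ.* (i ℕ.⊓ j))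
      rise = increments≤⇒growth≤ (C i j) (λ m m<n → proj₂ (increment∈ m m<n)) k 0
               (subst (_≤ n) (sym (ℕₚ.+-identityʳ k)) k≤n)
      below-rising : C i j k ℤ.≤ + (k ℕ.* (i ℕ.⊓ j))
      below-rising = subst (ℤ._≤ + (k ℕ.* (i ℕ.⊓ j)))
        (trans (cong₂ _-_ (cong (C i j) (ℕₚ.+-identityʳ k)) (zero₃ i j i≤n j≤n))
               (ℤₚ.+-identityʳ (C i j k)))
        rise
      fall : + ((n ∸ k) ℕ.* lowB n i j) ℤ.≤ C i j ((n ∸ k) ℕ.+ k) - C i j k
      fall = increments≥⇒growth≥ (C i j) (λ m m<n → proj₁ (increment∈ m m<n)) (n ∸ k) k
               (ℕₚ.≤-reflexive (ℕₚ.m∸n+n≡m k≤n))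
      below-falling : C i j k ℤ.≤ + (i ℕ.* j) - + ((n ∸ k) ℕ.* lowB n i j)
      below-falling = c≤x-y⇒y≤x-c {x = + (i ℕ.* j)}
        (subst (λ t → + ((n ∸ k) ℕ.* lowB n i j) ℤ.≤ t - C i j k)
          (trans (cong (C i j) (ℕₚ.m∸n+n≡m k≤n)) (full₃ i j i≤n j≤n))
          fall)

mainTheorem17 : (n : ℕ) → 1 ≤ n →
    IsCornerSum n (M n) ×
    ((C : Array) → IsCornerSum n C →
      ∀ i j k → i ≤ n → j ≤ n → k ≤ n → C i j k Data.Integer.≤ M n i j k)
mainTheorem17 n _ = M-isCornerSum n , λ C isC i j k i≤n j≤n k≤n → cornerSum≤M isC i≤n j≤n k k≤n
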